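{- Let $q$ be a prime power. Every shifting Costas polynomial in $\mathbb{F}_q[x]$ is a Costas polynomial.
   Context: A shifting Costas polynomial is a permutation polynomial $f\in\mathbb{F}_q[x]$ such that for every $d\in\mathbb{F}_q$ with $d\neq1$ there exists $a\in\mathbb{F}_q^*$ with $f(dx)-f(x)=f(ax)$ (as functions on $\mathbb{F}_q$, equivalently modulo $x^q-x$). A Costas polynomial is a polynomial $f\in\mathbb{F}_q[x]$ with $f(0)=0$ such that $x\mapsto f(dx)-f(x)$ is a permutation of $\mathbb{F}_q$ for every $d\in\mathbb{F}_q$, $d\neq1$. -}

module Defs where

open import Level using (Level; _⊔_) renaming (suc to lsuc)
open import Algebra.Bundles using (CommutativeRing)
open import Data.List using (List; []; _∷_)
open import Data.List.Relation.Unary.Any using (Any)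
open import Data.Product using (Σ; ∃; _×_)
open import Relation.Nullary using (¬_)
open import Relation.Binary.Definitions using (Decidable)

-- A finite field: a commutative ring with 1 ≠ 0 in which every nonzero
-- element is invertible, with decidable equality and a finite enumeration
-- of its elements.  (Its cardinality q is necessarily a prime power, and
-- every prime power arises.)
record FiniteField (c ℓ : Level) : Set (lsuc (c ⊔ ℓ)) where
  field
    commutativeRing : CommutativeRing c ℓ
  open CommutativeRing commutativeRing public
  field
    1≉0      : ¬ (1# ≈ 0#)
    inverse  : ∀ x → ¬ (x ≈ 0#) → ∃ λ y → x * y ≈ 1#
    _≟_      : Decidable _≈_
    elements : List Carrier
    complete : ∀ x → Any (x ≈_) elements

module _ {c ℓ : Level} (F : FiniteField c ℓ) where
  open FiniteField F

  -- polynomials in F[x] as coefficient lists, constant term first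
  Poly : Set c
  Poly = List Carrier

  eval : Poly → Carrier → Carrier
  eval []       x = 0#
  eval (a ∷ p)  x = a + x * eval p x

  _−_ : Carrier → Carrier → Carrier
  x − y = x + (- y)

  IsPermutation : (Carrier → Carrier) → Set (c ⊔ ℓ)
  IsPermutation g =
    (∀ x y → g x ≈ g y → x ≈ y) × (∀ y → ∃ λ x → g x ≈ y)

  IsPermutationPolynomial : Poly → Set (c ⊔ ℓ)
  IsPermutationPolynomial f = IsPermutation (eval f)

  IsShiftingCostas : Poly → Set (c ⊔ ℓ)
  IsShiftingCostas f =
    IsPermutationPolynomial f ×
    (∀ d → ¬ (d ≈ 1#) →
      ∃ λ a → ¬ (a ≈ 0#) × (∀ x → (eval f (d * x) − eval f x) ≈ eval f (a * x)))

  IsCostas : Poly → Set (c ⊔ ℓ)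
  IsCostas f =
    eval f 0# ≈ 0# ×
    (∀ d → ¬ (d ≈ 1#) → IsPermutation (λ x → eval f (d * x) − eval f x))

{-# OPTIONS --safe #-}
module Submission where

-- If f(dx) − f(x) = f(ax) with a ≠ 0, then x ↦ f(dx) − f(x) is the permutation f
-- precomposed with the bijection x ↦ ax.  Taking d = 0 gives 0 = f(0) − f(0) = f(a·0) = f(0).

open import Defs
open import Level using (Level)
open import Data.List using ([]; _∷_)
open import Data.Product using (∃; _,_)
open import Relation.Nullary using (¬_)
import Relation.Binary.Reasoning.Setoid as ≈-Reasoning

module _ {c ℓ : Level} (F : FiniteField c ℓ) where
  open FiniteField F
  open ≈-Reasoning setoid

  eval-cong : ∀ (p : Poly F) {x y} → x ≈ y → eval F p x ≈ eval F p y
  eval-cong []      x≈y = refl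
  eval-cong (a ∷ p) x≈y = +-cong refl (*-cong x≈y (eval-cong p x≈y))

  permutation-resp-≈ : ∀ {g h : Carrier → Carrier} →
                       (∀ x → g x ≈ h x) → IsPermutation F g → IsPermutation F h
  permutation-resp-≈ g≈h (g-inj , g-surj) = h-inj , h-surj
    where
      h-inj : ∀ x y → _ → x ≈ y
      h-inj x y hx≈hy = g-inj x y (trans (g≈h x) (trans hx≈hy (sym (g≈h y))))
      h-surj : ∀ y → ∃ λ x → _ ≈ y
      h-surj y with g-surj y
      ... | x , gx≈y = x , trans (sym (g≈h x)) gx≈y

  permutation-∘ : ∀ {g h : Carrier → Carrier} → (∀ {x y} → x ≈ y → g x ≈ g y) →
                  IsPermutation F g → IsPermutation F h → IsPermutation F (λ x → g (h x))
  permutation-∘ g-cong (g-inj , g-surj) (h-inj , h-surj) = gh-inj , gh-surj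
    where
      gh-inj : ∀ x y → _ → x ≈ y
      gh-inj x y ghx≈ghy = h-inj x y (g-inj _ _ ghx≈ghy)
      gh-surj : ∀ y → ∃ λ x → _ ≈ y
      gh-surj y with g-surj y
      ... | z , gz≈y with h-surj z
      ... | x , hx≈z = x , trans (g-cong hx≈z) gz≈y

  *-cancelˡ-inverse : ∀ {a b} → a * b ≈ 1# → ∀ x → a * (b * x) ≈ x
  *-cancelˡ-inverse {a} {b} ab≈1 x = begin
    a * (b * x) ≈⟨ sym (*-assoc a b x) ⟩
    (a * b) * x ≈⟨ *-cong ab≈1 refl ⟩
    1# * x      ≈⟨ *-identityˡ x ⟩
    x           ∎

  scaling-permutation : ∀ {a} → ¬ (a ≈ 0#) → IsPermutation F (a *_)
  scaling-permutation {a} a≉0 with inverse a a≉0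
  ... | b , ab≈1 = injective , surjective
    where
      ba≈1 : b * a ≈ 1#
      ba≈1 = trans (*-comm b a) ab≈1
      injective : ∀ x y → a * x ≈ a * y → x ≈ y
      injective x y ax≈ay = begin
        x           ≈⟨ sym (*-cancelˡ-inverse ba≈1 x) ⟩
        b * (a * x) ≈⟨ *-cong refl ax≈ay ⟩
        b * (a * y) ≈⟨ *-cancelˡ-inverse ba≈1 y ⟩
        y           ∎
      surjective : ∀ y → ∃ λ x → a * x ≈ y
      surjective y = b * y , *-cancelˡ-inverse ab≈1 y

  shifting-zero : ∀ (f : Poly F) {a} →
                  (∀ x → _−_ F (eval F f (0# * x)) (eval F f x) ≈ eval F f (a * x)) →
                  eval F f 0# ≈ 0#
  shifting-zero f {a} shift = sym (begin
    0#                                  ≈⟨ sym (-‿inverseʳ (eval F f 0#)) ⟩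
    eval F f 0# + - eval F f 0#         ≈⟨ +-cong (eval-cong f (sym (zeroˡ 0#))) refl ⟩
    eval F f (0# * 0#) + - eval F f 0#  ≈⟨ shift 0# ⟩
    eval F f (a * 0#)                   ≈⟨ eval-cong f (zeroʳ a) ⟩
    eval F f 0#                         ∎)

lemma7p2 : ∀ {c ℓ : Level} (F : FiniteField c ℓ) (f : Poly F) →
             IsShiftingCostas F f → IsCostas F f
lemma7p2 F f (f-perm , shifting) = f0≈0 , difference-permutation
  where
    open FiniteField F

    f0≈0 : eval F f 0# ≈ 0#
    f0≈0 with shifting 0# (λ 0≈1 → 1≉0 (sym 0≈1))
    ... | _ , _ , shift = shifting-zero F f shift

    difference-permutation : ∀ d → ¬ (d ≈ 1#) →
                             IsPermutation F (λ x → _−_ F (eval F f (d * x)) (eval F f x))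
    difference-permutation d d≉1 with shifting d d≉1
    ... | a , a≉0 , shift =
      permutation-resp-≈ F (λ x → sym (shift x))
        (permutation-∘ F (eval-cong F f) f-perm (scaling-permutation F a≉0))
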